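{- Let $\Gamma$, $\Delta$ and $\Theta$ be contexts (with $\Gamma,\Delta$ having disjoint variables) and suppose $\Theta$ is atomic. If $\Gamma\le^s\Theta$ and $\Delta\le^s\Theta$, then $\Gamma,\Delta\le^s\Theta$.
   Context: Simply typed $\lambda$-calculus over base type $0$; every type is uniquely $[A_1,\dots,A_n]:=A_1\to\cdots\to A_n\to0$; $1:=[0]$. A context is a finite list of distinct typed variables; $\{\Gamma\}$ its variable set; terms identified up to $\beta\eta$ ($=_{\beta\eta}$); $\Lambda^\Xi(A)$ = terms of type $A$ with free variables in $\{\Xi\}$. A substitution $\varrho$ from $\Gamma$ to $\Delta$ assigns $\varrho_c\in\Lambda^\Delta(C)$ to each $c^C\in\{\Gamma\}$; for a context $\Xi$ of fresh variables, $\varrho^\Xi$ is $\varrho$ on $\{\Gamma\}$ and the identity on $\{\Xi\}$, and $\hat\varrho^\Xi\colon\Lambda^{\Xi,\Gamma}(0)\to\Lambda^{\Xi,\Delta}(0)$, $M\mapsto M[\Gamma:=\varrho]$. $\Gamma\le^s\Delta$ means there is a substitution $\varrho$ from $\Gamma$ to $\Delta$ with $\hat\varrho^\Xi$ injective for every fresh context $\Xi$. $\varrho$ is an atomic reduction if for every fresh $\Xi$, all $a^A,b^B\in\{\Xi,\Gamma\}$ with $A\equiv[A_1,\dots,A_n]$, $B\equiv[B_1,\dots,B_m]$, and all $M_i\in\Lambda^{\Xi,\Delta}(A_i)$, $N_i\in\Lambda^{\Xi,\Delta}(B_i)$: $\varrho^\Xi_aM_1\cdots M_n=_{\beta\eta}\varrho^\Xi_bN_1\cdots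 N_m$ implies $a=b$ and all $M_i=N_i$. $\Gamma\le^a\Delta$ means an atomic reduction from $\Gamma$ to $\Delta$ exists. A context $\Theta$ is atomic if $f_1^1,f_2^1\le^a\Theta$ (two distinct variables of type $1$). -}

module Defs where

open import Data.List using (List; []; _∷_; _++_)
open import Data.Product using (Σ)

-- Simple types over the single base type ι (= 0).
-- Every type is uniquely ι or A ⇒ B, hence uniquely [A₁,…,Aₙ] = A₁ ⇒ ⋯ ⇒ Aₙ ⇒ ι.
infixr 7 _⇒_
data Ty : Set where
  ι   : Ty
  _⇒_ : Ty → Ty → Ty

[_]ty : List Ty → Ty
[ [] ]ty = ι
[ A ∷ As ]ty = A ⇒ [ As ]ty

𝟙 : Ty
𝟙 = [ ι ∷ [] ]ty

-- Contexts: lists of typed variables (de Bruijn; variables are positions,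
-- so distinct by construction; concatenation gives disjoint variable sets).
Ctx : Set
Ctx = List Ty

infix 4 _∋_
data _∋_ : Ctx → Ty → Set where
  here  : ∀ {Γ A} → (A ∷ Γ) ∋ A
  there : ∀ {Γ A B} → Γ ∋ A → (B ∷ Γ) ∋ A

-- Intrinsically typed terms: Tm Γ A = Λ^Γ(A) (before quotienting by βη).
data Tm (Γ : Ctx) : Ty → Set where
  var : ∀ {A} → Γ ∋ A → Tm Γ A
  lam : ∀ {A B} → Tm (A ∷ Γ) B → Tm Γ (A ⇒ B)
  app : ∀ {A B} → Tm Γ (A ⇒ B) → Tm Γ A → Tm Γ B

Ren : Ctx → Ctx → Set
Ren Γ Δ = ∀ {A} → Γ ∋ A → Δ ∋ A

liftR : ∀ {Γ Δ B} → Ren Γ Δ → Ren (B ∷ Γ) (B ∷ Δ)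
liftR ρ here      = here
liftR ρ (there x) = there (ρ x)

ren : ∀ {Γ Δ A} → Ren Γ Δ → Tm Γ A → Tm Δ A
ren ρ (var x)   = var (ρ x)
ren ρ (lam t)   = lam (ren (liftR ρ) t)
ren ρ (app t u) = app (ren ρ t) (ren ρ u)

wk : ∀ {Γ A B} → Tm Γ A → Tm (B ∷ Γ) A
wk = ren there

Sub : Ctx → Ctx → Set
Sub Γ Δ = ∀ {A} → Γ ∋ A → Tm Δ A

lift : ∀ {Γ Δ B} → Sub Γ Δ → Sub (B ∷ Γ) (B ∷ Δ)
lift σ here      = var here
lift σ (there x) = wk (σ x)

sub : ∀ {Γ Δ A} → Sub Γ Δ → Tm Γ A → Tm Δ A
sub σ (var x)   = σ x
sub σ (lam t)   = lam (sub (lift σ) t)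
sub σ (app t u) = app (sub σ t) (sub σ u)

_[_] : ∀ {Γ A B} → Tm (A ∷ Γ) B → Tm Γ A → Tm Γ B
t [ u ] = sub σ t
  where
  σ : Sub _ _
  σ here      = u
  σ (there x) = var x

infix 4 _≈_
data _≈_ {Γ : Ctx} : ∀ {A} → Tm Γ A → Tm Γ A → Set where
  β        : ∀ {A B} (t : Tm (A ∷ Γ) B) (u : Tm Γ A) → app (lam t) u ≈ t [ u ]
  η        : ∀ {A B} (t : Tm Γ (A ⇒ B)) → t ≈ lam (app (wk t) (var here))
  ≈-refl   : ∀ {A} {t : Tm Γ A} → t ≈ t
  ≈-sym    : ∀ {A} {t u : Tm Γ A} → t ≈ u → u ≈ t
  ≈-trans  : ∀ {A} {t u v : Tm Γ A} → t ≈ u → u ≈ v → t ≈ v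
  cong-lam : ∀ {A B} {t u : Tm (A ∷ Γ) B} → _≈_ {A ∷ Γ} t u → lam t ≈ lam u
  cong-app : ∀ {A B} {t t' : Tm Γ (A ⇒ B)} {u u' : Tm Γ A} →
             t ≈ t' → u ≈ u' → app t u ≈ app t' u'

-- ϱ^Ξ : identity on the fresh context Ξ, ϱ on Γ   (context "Ξ,Γ" is Ξ ++ Γ)
liftΞ : ∀ {Γ Δ} (Ξ : Ctx) → Sub Γ Δ → Sub (Ξ ++ Γ) (Ξ ++ Δ)
liftΞ []      σ = σ
liftΞ (A ∷ Ξ) σ = lift (liftΞ Ξ σ)

InjectiveSub : ∀ {Γ Δ} → Sub Γ Δ → Set
InjectiveSub {Γ} {Δ} σ =
  (Ξ : Ctx) (M N : Tm (Ξ ++ Γ) ι) →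
  sub (liftΞ Ξ σ) M ≈ sub (liftΞ Ξ σ) N → M ≈ N

infix 4 _≤ˢ_ _≤ᵃ_
_≤ˢ_ : Ctx → Ctx → Set
Γ ≤ˢ Δ = Σ (Sub Γ Δ) InjectiveSub

infixr 5 _∷ₛ_
data Spine (Δ : Ctx) : Ty → Set where
  []ₛ  : Spine Δ ι
  _∷ₛ_ : ∀ {A B} → Tm Δ A → Spine Δ B → Spine Δ (A ⇒ B)

apply : ∀ {Δ A} → Tm Δ A → Spine Δ A → Tm Δ ι
apply t []ₛ       = t
apply t (u ∷ₛ us) = apply (app t u) us

data SpineEq {Δ : Ctx} : ∀ {A} → Spine Δ A → Spine Δ A → Set where
  []ₑ  : SpineEq []ₛ []ₛ
  _∷ₑ_ : ∀ {A B} {M N : Tm Δ A} {Ms Ns : Spine Δ B} →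
         M ≈ N → SpineEq Ms Ns → SpineEq (M ∷ₛ Ms) (N ∷ₛ Ns)

data HeadEq {Γ Δ : Ctx} : ∀ {A B} → Γ ∋ A → Γ ∋ B → Spine Δ A → Spine Δ B → Set where
  same : ∀ {A} {a : Γ ∋ A} {Ms Ns : Spine Δ A} → SpineEq Ms Ns → HeadEq a a Ms Ns

IsAtomicReduction : ∀ {Γ Δ} → Sub Γ Δ → Set
IsAtomicReduction {Γ} {Δ} σ =
  (Ξ : Ctx) {A B : Ty} (a : (Ξ ++ Γ) ∋ A) (b : (Ξ ++ Γ) ∋ B)
  (Ms : Spine (Ξ ++ Δ) A) (Ns : Spine (Ξ ++ Δ) B) →
  apply (liftΞ Ξ σ a) Ms ≈ apply (liftΞ Ξ σ b) Ns → HeadEq a b Ms Ns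

_≤ᵃ_ : Ctx → Ctx → Set
Γ ≤ᵃ Δ = Σ (Sub Γ Δ) IsAtomicReduction

AtomicCtx : Ctx → Set
AtomicCtx Θ = (𝟙 ∷ 𝟙 ∷ []) ≤ᵃ Θ

-- If σ : Γ → Θ and τ : Δ → Θ are injective, then so is σ ⊕ τ : Γ ++ Δ → Θ ++ Θ, since it
-- factors into liftings of σ and of τ by fresh variables, up to reordering the context.
-- It remains to embed Θ ++ Θ into Θ injectively. With f₁, f₂ the images of the atomic
-- reduction, send θ in the left copy to λx⃗. f₁ (θ x⃗) and θ in the right copy to λx⃗. f₂ (θ x⃗).
-- Comparing η-long β-normal forms, atomicity recovers from the image of a neutral term its
-- head, including the copy it lives in, and its arguments.

module Submission where

open import Data.List using ([]; _∷_; _++_)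
open import Data.Product using (Σ; _,_)
open import Data.Empty using (⊥; ⊥-elim)
open import Relation.Binary.PropositionalEquality
  using (_≡_; refl; sym; trans; cong; cong₂; module ≡-Reasoning)

open import Defs

-- Renaming and substitution

infix 4 _≗ʳ_ _≗ˢ_

_≗ʳ_ : ∀ {Γ Δ} → Ren Γ Δ → Ren Γ Δ → Set
_≗ʳ_ {Γ} ρ ρ' = ∀ {A} (x : Γ ∋ A) → ρ x ≡ ρ' x

_≗ˢ_ : ∀ {Γ Δ} → Sub Γ Δ → Sub Γ Δ → Set
_≗ˢ_ {Γ} σ σ' = ∀ {A} (x : Γ ∋ A) → σ x ≡ σ' x

infixr 9 _∘ˢ_

_∘ˢ_ : ∀ {Γ Δ Ε} → Sub Δ Ε → Sub Γ Δ → Sub Γ Ε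
(σ' ∘ˢ σ) x = sub σ' (σ x)

liftR-cong : ∀ {Γ Δ B} {ρ ρ' : Ren Γ Δ} → ρ ≗ʳ ρ' → liftR {B = B} ρ ≗ʳ liftR ρ'
liftR-cong p here      = refl
liftR-cong p (there x) = cong there (p x)

ren-cong : ∀ {Γ Δ A} {ρ ρ' : Ren Γ Δ} → ρ ≗ʳ ρ' → (t : Tm Γ A) → ren ρ t ≡ ren ρ' t
ren-cong p (var x)   = cong var (p x)
ren-cong p (lam t)   = cong lam (ren-cong (liftR-cong p) t)
ren-cong p (app t u) = cong₂ app (ren-cong p t) (ren-cong p u)

lift-cong : ∀ {Γ Δ B} {σ σ' : Sub Γ Δ} → σ ≗ˢ σ' → lift {B = B} σ ≗ˢ lift σ'
lift-cong p here      = refl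
lift-cong p (there x) = cong wk (p x)

sub-cong : ∀ {Γ Δ A} {σ σ' : Sub Γ Δ} → σ ≗ˢ σ' → (t : Tm Γ A) → sub σ t ≡ sub σ' t
sub-cong p (var x)   = p x
sub-cong p (lam t)   = cong lam (sub-cong (lift-cong p) t)
sub-cong p (app t u) = cong₂ app (sub-cong p t) (sub-cong p u)

ren-id : ∀ {Γ A} (t : Tm Γ A) → ren (λ x → x) t ≡ t
ren-id (var x)   = refl
ren-id (lam t)   = cong lam (trans (ren-cong (λ { here → refl ; (there x) → refl }) t) (ren-id t))
ren-id (app t u) = cong₂ app (ren-id t) (ren-id u)

ren-ren : ∀ {Γ Δ Ε A} (ρ' : Ren Δ Ε) (ρ : Ren Γ Δ) (t : Tm Γ A) →
          ren ρ' (ren ρ t) ≡ ren (λ x → ρ' (ρ x)) t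
ren-ren ρ' ρ (var x)   = refl
ren-ren ρ' ρ (lam t)   = cong lam (trans (ren-ren (liftR ρ') (liftR ρ) t)
                                        (ren-cong (λ { here → refl ; (there x) → refl }) t))
ren-ren ρ' ρ (app t u) = cong₂ app (ren-ren ρ' ρ t) (ren-ren ρ' ρ u)

ren-sub : ∀ {Γ Δ Ε A} (ρ : Ren Δ Ε) (σ : Sub Γ Δ) (t : Tm Γ A) →
          ren ρ (sub σ t) ≡ sub (λ x → ren ρ (σ x)) t
ren-sub ρ σ (var x)   = refl
ren-sub ρ σ (lam t)   = cong lam (trans (ren-sub (liftR ρ) (lift σ) t) (sub-cong lift-ren t))
  where
  lift-ren : ∀ {A} (x : _ ∋ A) → ren (liftR ρ) (lift σ x) ≡ lift (λ y → ren ρ (σ y)) x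
  lift-ren here      = refl
  lift-ren (there x) = trans (ren-ren (liftR ρ) there (σ x)) (sym (ren-ren there ρ (σ x)))
ren-sub ρ σ (app t u) = cong₂ app (ren-sub ρ σ t) (ren-sub ρ σ u)

sub-ren : ∀ {Γ Δ Ε A} (σ : Sub Δ Ε) (ρ : Ren Γ Δ) (t : Tm Γ A) →
          sub σ (ren ρ t) ≡ sub (λ x → σ (ρ x)) t
sub-ren σ ρ (var x)   = refl
sub-ren σ ρ (lam t)   = cong lam (trans (sub-ren (lift σ) (liftR ρ) t)
                                        (sub-cong (λ { here → refl ; (there x) → refl }) t))
sub-ren σ ρ (app t u) = cong₂ app (sub-ren σ ρ t) (sub-ren σ ρ u)

lift-wk : ∀ {Γ Δ A B} (σ : Sub Γ Δ) (t : Tm Γ A) → sub (lift {B = B} σ) (wk t) ≡ wk (sub σ t)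
lift-wk σ t = trans (sub-ren (lift σ) there t) (sym (ren-sub there σ t))

sub-sub : ∀ {Γ Δ Ε A} (σ' : Sub Δ Ε) (σ : Sub Γ Δ) (t : Tm Γ A) →
          sub σ' (sub σ t) ≡ sub (σ' ∘ˢ σ) t
sub-sub σ' σ (var x)   = refl
sub-sub σ' σ (lam t)   = cong lam (trans (sub-sub (lift σ') (lift σ) t)
                                        (sub-cong (λ { here → refl ; (there x) → lift-wk σ' (σ x) }) t))
sub-sub σ' σ (app t u) = cong₂ app (sub-sub σ' σ t) (sub-sub σ' σ u)

sub-id : ∀ {Γ A} (t : Tm Γ A) → sub var t ≡ t
sub-id (var x)   = refl
sub-id (lam t)   = cong lam (trans (sub-cong (λ { here → refl ; (there x) → refl }) t) (sub-id t))
sub-id (app t u) = cong₂ app (sub-id t) (sub-id u)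

ren-as-sub : ∀ {Γ Δ A} (ρ : Ren Γ Δ) (t : Tm Γ A) → ren ρ t ≡ sub (λ x → var (ρ x)) t
ren-as-sub ρ t = trans (sym (sub-id (ren ρ t))) (sub-ren var ρ t)

wk-[] : ∀ {Γ A B} (t : Tm Γ A) (u : Tm Γ B) → wk t [ u ] ≡ t
wk-[] t u = trans (sub-ren _ there t) (sub-id t)

liftΞ-∘ˢ : ∀ Ξ {Γ Δ Ε} (σ' : Sub Δ Ε) (σ : Sub Γ Δ) → liftΞ Ξ (σ' ∘ˢ σ) ≗ˢ liftΞ Ξ σ' ∘ˢ liftΞ Ξ σ
liftΞ-∘ˢ []      σ' σ x         = refl
liftΞ-∘ˢ (B ∷ Ξ) σ' σ here      = refl
liftΞ-∘ˢ (B ∷ Ξ) σ' σ (there x) =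
  trans (cong wk (liftΞ-∘ˢ Ξ σ' σ x)) (sym (lift-wk (liftΞ Ξ σ') (liftΞ Ξ σ x)))

≡⇒≈ : ∀ {Γ A} {t u : Tm Γ A} → t ≡ u → t ≈ u
≡⇒≈ refl = ≈-refl

ren-resp-≈ : ∀ {Γ Δ A} (ρ : Ren Γ Δ) {t u : Tm Γ A} → t ≈ u → ren ρ t ≈ ren ρ u
ren-resp-≈ ρ (β t u)        = ≈-trans (β _ _) (≡⇒≈ (trans (sub-ren _ (liftR ρ) t)
  (trans (sub-cong (λ { here → refl ; (there x) → refl }) t) (sym (ren-sub ρ _ t)))))
ren-resp-≈ ρ (η t)          = ≈-trans (η _) (cong-lam (cong-app
  (≡⇒≈ (trans (ren-ren there ρ t) (sym (ren-ren (liftR ρ) there t)))) ≈-refl))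
ren-resp-≈ ρ ≈-refl         = ≈-refl
ren-resp-≈ ρ (≈-sym p)      = ≈-sym (ren-resp-≈ ρ p)
ren-resp-≈ ρ (≈-trans p q)  = ≈-trans (ren-resp-≈ ρ p) (ren-resp-≈ ρ q)
ren-resp-≈ ρ (cong-lam p)   = cong-lam (ren-resp-≈ (liftR ρ) p)
ren-resp-≈ ρ (cong-app p q) = cong-app (ren-resp-≈ ρ p) (ren-resp-≈ ρ q)

sub-resp-≈ : ∀ {Γ Δ A} (σ : Sub Γ Δ) {t u : Tm Γ A} → t ≈ u → sub σ t ≈ sub σ u
sub-resp-≈ σ (β t u)        = ≈-trans (β _ _) (≡⇒≈ (trans (sub-sub _ (lift σ) t)
  (trans (sub-cong (λ { here → refl ; (there x) → wk-[] (σ x) _ }) t) (sym (sub-sub σ _ t)))))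
sub-resp-≈ σ (η t)          = ≈-trans (η _) (cong-lam (cong-app (≡⇒≈ (sym (lift-wk σ t))) ≈-refl))
sub-resp-≈ σ ≈-refl         = ≈-refl
sub-resp-≈ σ (≈-sym p)      = ≈-sym (sub-resp-≈ σ p)
sub-resp-≈ σ (≈-trans p q)  = ≈-trans (sub-resp-≈ σ p) (sub-resp-≈ σ q)
sub-resp-≈ σ (cong-lam p)   = cong-lam (sub-resp-≈ (lift σ) p)
sub-resp-≈ σ (cong-app p q) = cong-app (sub-resp-≈ σ p) (sub-resp-≈ σ q)

lam-injective : ∀ {Γ A B} {t u : Tm (A ∷ Γ) B} → lam t ≈ lam u → t ≈ u
lam-injective {t = t} {u} p =
  ≈-trans (≡⇒≈ (sym (unwk t))) (≈-trans (≈-sym (β _ _))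
    (≈-trans (cong-app (ren-resp-≈ there p) ≈-refl) (≈-trans (β _ _) (≡⇒≈ (unwk u)))))
  where
  unwk : ∀ s → ren (liftR there) s [ var here ] ≡ s
  unwk s = trans (sub-ren _ (liftR there) s)
                 (trans (sub-cong (λ { here → refl ; (there x) → refl }) s) (sub-id s))

ren-reflects-≈ : ∀ {Γ Δ A} (ρ : Ren Γ Δ) (ρ⁻¹ : Ren Δ Γ) → (∀ {B} (x : Γ ∋ B) → ρ⁻¹ (ρ x) ≡ x) →
                 {t u : Tm Γ A} → ren ρ t ≈ ren ρ u → t ≈ u
ren-reflects-≈ ρ ρ⁻¹ inv {t} {u} p =
  ≈-trans (≡⇒≈ (sym (back t))) (≈-trans (ren-resp-≈ ρ⁻¹ p) (≡⇒≈ (back u)))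
  where
  back : ∀ s → ren ρ⁻¹ (ren ρ s) ≡ s
  back s = trans (ren-ren ρ⁻¹ ρ s) (trans (ren-cong inv s) (ren-id s))

-- Normalisation by evaluation

infixr 5 _∷ᵃ_
data Args (Γ : Ctx) : Ty → Ty → Set where
  []ᵃ  : ∀ {T} → Args Γ T T
  _∷ᵃ_ : ∀ {A B T} → Tm Γ A → Args Γ B T → Args Γ (A ⇒ B) T

apps : ∀ {Γ C T} → Tm Γ C → Args Γ C T → Tm Γ T
apps t []ᵃ      = t
apps t (u ∷ᵃ S) = apps (app t u) S

toSpine : ∀ {Γ C} → Args Γ C ι → Spine Γ C
toSpine []ᵃ      = []ₛ
toSpine (u ∷ᵃ S) = u ∷ₛ toSpine S

apps≡apply : ∀ {Γ C} (t : Tm Γ C) (S : Args Γ C ι) → apps t S ≡ apply t (toSpine S)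
apps≡apply t []ᵃ      = refl
apps≡apply t (u ∷ᵃ S) = apps≡apply (app t u) S

renArgs : ∀ {Γ Δ C T} → Ren Γ Δ → Args Γ C T → Args Δ C T
renArgs ρ []ᵃ      = []ᵃ
renArgs ρ (u ∷ᵃ S) = ren ρ u ∷ᵃ renArgs ρ S

subArgs : ∀ {Γ Δ C T} → Sub Γ Δ → Args Γ C T → Args Δ C T
subArgs σ []ᵃ      = []ᵃ
subArgs σ (u ∷ᵃ S) = sub σ u ∷ᵃ subArgs σ S

ren-apps : ∀ {Γ Δ C T} (ρ : Ren Γ Δ) (t : Tm Γ C) (S : Args Γ C T) →
           ren ρ (apps t S) ≡ apps (ren ρ t) (renArgs ρ S)
ren-apps ρ t []ᵃ      = refl
ren-apps ρ t (u ∷ᵃ S) = ren-apps ρ (app t u) S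

sub-apps : ∀ {Γ Δ C T} (σ : Sub Γ Δ) (t : Tm Γ C) (S : Args Γ C T) →
           sub σ (apps t S) ≡ apps (sub σ t) (subArgs σ S)
sub-apps σ t []ᵃ      = refl
sub-apps σ t (u ∷ᵃ S) = sub-apps σ (app t u) S

apps-resp-≈ : ∀ {Γ C T} {t t' : Tm Γ C} (S : Args Γ C T) → t ≈ t' → apps t S ≈ apps t' S
apps-resp-≈ []ᵃ      p = p
apps-resp-≈ (u ∷ᵃ S) p = apps-resp-≈ S (cong-app p ≈-refl)

mutual
  data Nf (Γ : Ctx) : Ty → Set where
    lamⁿ : ∀ {A B} → Nf (A ∷ Γ) B → Nf Γ (A ⇒ B)
    neuⁿ : ∀ {C} → Γ ∋ C → NfArgs Γ C ι → Nf Γ ι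

  data NfArgs (Γ : Ctx) : Ty → Ty → Set where
    []ⁿ  : ∀ {T} → NfArgs Γ T T
    _∷ⁿ_ : ∀ {A B T} → Nf Γ A → NfArgs Γ B T → NfArgs Γ (A ⇒ B) T

mutual
  ⌜_⌝ : ∀ {Γ A} → Nf Γ A → Tm Γ A
  ⌜ lamⁿ n ⌝   = lam ⌜ n ⌝
  ⌜ neuⁿ x S ⌝ = apps (var x) ⌜ S ⌝ᵃ

  ⌜_⌝ᵃ : ∀ {Γ C T} → NfArgs Γ C T → Args Γ C T
  ⌜ []ⁿ ⌝ᵃ    = []ᵃ
  ⌜ n ∷ⁿ S ⌝ᵃ = ⌜ n ⌝ ∷ᵃ ⌜ S ⌝ᵃ

mutual
  renNf : ∀ {Γ Δ A} → Ren Γ Δ → Nf Γ A → Nf Δ A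
  renNf ρ (lamⁿ n)   = lamⁿ (renNf (liftR ρ) n)
  renNf ρ (neuⁿ x S) = neuⁿ (ρ x) (renNfArgs ρ S)

  renNfArgs : ∀ {Γ Δ C T} → Ren Γ Δ → NfArgs Γ C T → NfArgs Δ C T
  renNfArgs ρ []ⁿ      = []ⁿ
  renNfArgs ρ (n ∷ⁿ S) = renNf ρ n ∷ⁿ renNfArgs ρ S

mutual
  ren-⌜⌝ : ∀ {Γ Δ A} (ρ : Ren Γ Δ) (n : Nf Γ A) → ren ρ ⌜ n ⌝ ≡ ⌜ renNf ρ n ⌝
  ren-⌜⌝ ρ (lamⁿ n)   = cong lam (ren-⌜⌝ (liftR ρ) n)
  ren-⌜⌝ ρ (neuⁿ x S) = trans (ren-apps ρ (var x) ⌜ S ⌝ᵃ) (cong (apps (var (ρ x))) (ren-⌜⌝ᵃ ρ S))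

  ren-⌜⌝ᵃ : ∀ {Γ Δ C T} (ρ : Ren Γ Δ) (S : NfArgs Γ C T) → renArgs ρ ⌜ S ⌝ᵃ ≡ ⌜ renNfArgs ρ S ⌝ᵃ
  ren-⌜⌝ᵃ ρ []ⁿ      = refl
  ren-⌜⌝ᵃ ρ (n ∷ⁿ S) = cong₂ _∷ᵃ_ (ren-⌜⌝ ρ n) (ren-⌜⌝ᵃ ρ S)

snoc : ∀ {Γ C A B} → NfArgs Γ C (A ⇒ B) → Nf Γ A → NfArgs Γ C B
snoc []ⁿ      n = n ∷ⁿ []ⁿ
snoc (m ∷ⁿ S) n = m ∷ⁿ snoc S n

apps-snoc : ∀ {Γ C A B} (t : Tm Γ C) (S : NfArgs Γ C (A ⇒ B)) (n : Nf Γ A) →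
            apps t ⌜ snoc S n ⌝ᵃ ≡ app (apps t ⌜ S ⌝ᵃ) ⌜ n ⌝
apps-snoc t []ⁿ      n = refl
apps-snoc t (m ∷ⁿ S) n = apps-snoc (app t ⌜ m ⌝) S n

HasNf : ∀ {Γ A} → Tm Γ A → Set
HasNf {Γ} {A} t = Σ (Nf Γ A) (λ n → t ≈ ⌜ n ⌝)

Red : ∀ {Γ} A → Tm Γ A → Set
Red ι       t = HasNf t
Red (A ⇒ B) t = ∀ {Δ} (ρ : Ren _ Δ) {u : Tm Δ A} → Red A u → Red B (app (ren ρ t) u)

Red-resp-≈ : ∀ {Γ} A {t t' : Tm Γ A} → t ≈ t' → Red A t → Red A t'
Red-resp-≈ ι       p (n , q) = n , ≈-trans (≈-sym p) q
Red-resp-≈ (A ⇒ B) p r ρ ru  = Red-resp-≈ B (cong-app (ren-resp-≈ ρ p) ≈-refl) (r ρ ru)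

Red-ren : ∀ {Γ Δ} A (ρ : Ren Γ Δ) {t : Tm Γ A} → Red A t → Red A (ren ρ t)
Red-ren ι       ρ (n , q) = renNf ρ n , ≈-trans (ren-resp-≈ ρ q) (≡⇒≈ (ren-⌜⌝ ρ n))
Red-ren (A ⇒ B) ρ {t} r ρ' ru =
  Red-resp-≈ B (cong-app (≡⇒≈ (sym (ren-ren ρ' ρ t))) ≈-refl) (r (λ x → ρ' (ρ x)) ru)

mutual
  reify : ∀ {Γ} A {t : Tm Γ A} → Red A t → HasNf t
  reify ι       r = r
  reify (A ⇒ B) {t} r with reify B (r there (reflect A here []ⁿ))
  ... | n , q = lamⁿ n , ≈-trans (η t) (cong-lam q)

  reflect : ∀ {Γ} A {C} (x : Γ ∋ C) (S : NfArgs Γ C A) → Red A (apps (var x) ⌜ S ⌝ᵃ)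
  reflect ι       x S = neuⁿ x S , ≈-refl
  reflect (A ⇒ B) x S ρ {u} ru with reify A ru
  ... | n , q = Red-resp-≈ B eq (reflect B (ρ x) (snoc (renNfArgs ρ S) n))
    where
    eq : apps (var (ρ x)) ⌜ snoc (renNfArgs ρ S) n ⌝ᵃ ≈ app (ren ρ (apps (var x) ⌜ S ⌝ᵃ)) u
    eq = ≈-trans (≡⇒≈ (apps-snoc (var (ρ x)) (renNfArgs ρ S) n))
           (cong-app (≡⇒≈ (sym (trans (ren-apps ρ (var x) ⌜ S ⌝ᵃ)
                                      (cong (apps (var (ρ x))) (ren-⌜⌝ᵃ ρ S)))))
                     (≈-sym q))

fundamental : ∀ {Γ Δ A} (σ : Sub Γ Δ) → (∀ {B} (x : Γ ∋ B) → Red B (σ x)) →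
              (t : Tm Γ A) → Red A (sub σ t)
fundamental σ σ-red (var x) = σ-red x
fundamental σ σ-red (app {A} {B} t u) =
  Red-resp-≈ B (cong-app (≡⇒≈ (ren-id (sub σ t))) ≈-refl)
             (fundamental σ σ-red t (λ x → x) (fundamental σ σ-red u))
fundamental {A = A ⇒ B} σ σ-red (lam t) ρ {u} ru =
  Red-resp-≈ B (≈-sym (≈-trans (β _ _) (≡⇒≈ eq))) (fundamental σ' σ'-red t)
  where
  σ' : Sub _ _
  σ' here      = u
  σ' (there x) = ren ρ (σ x)
  σ'-red : ∀ {C} (x : _ ∋ C) → Red C (σ' x)
  σ'-red here          = ru
  σ'-red {C} (there x) = Red-ren C ρ (σ-red x)
  eq : ren (liftR ρ) (sub (lift σ) t) [ u ] ≡ sub σ' t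
  eq = trans (sub-ren _ (liftR ρ) (sub (lift σ) t)) (trans (sub-sub _ (lift σ) t)
         (sub-cong (λ { here → refl
                      ; (there x) → trans (sub-ren _ there (σ x)) (sym (ren-as-sub ρ (σ x))) }) t))

normalise : ∀ {Γ A} (t : Tm Γ A) → HasNf t
normalise {A = A} t with reify A (fundamental var (λ {B} x → reflect B x []ⁿ) t)
... | n , q = n , ≈-trans (≡⇒≈ (sym (sub-id t))) q

injˡ : ∀ {Ξ Γ A} → Ξ ∋ A → (Ξ ++ Γ) ∋ A
injˡ here      = here
injˡ (there x) = there (injˡ x)

injʳ : ∀ Ξ {Γ A} → Γ ∋ A → (Ξ ++ Γ) ∋ A
injʳ []      x = x
injʳ (B ∷ Ξ) x = there (injʳ Ξ x)

data Split (Ξ : Ctx) {Γ : Ctx} {A : Ty} : (Ξ ++ Γ) ∋ A → Set where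
  inˡ : (z : Ξ ∋ A) → Split Ξ (injˡ z)
  inʳ : (w : Γ ∋ A) → Split Ξ (injʳ Ξ w)

split : ∀ Ξ {Γ A} (x : (Ξ ++ Γ) ∋ A) → Split Ξ x
split []      x         = inʳ x
split (B ∷ Ξ) here      = inˡ here
split (B ∷ Ξ) (there x) with split Ξ x
... | inˡ z = inˡ (there z)
... | inʳ w = inʳ w

copair : ∀ Ξ {Γ} {F : Ty → Set} → (∀ {A} → Ξ ∋ A → F A) → (∀ {A} → Γ ∋ A → F A) →
         ∀ {A} → (Ξ ++ Γ) ∋ A → F A
copair []      f g x         = g x
copair (B ∷ Ξ) f g here      = f here
copair (B ∷ Ξ) f g (there x) = copair Ξ (λ y → f (there y)) g x

copair-injˡ : ∀ Ξ {Γ} {F : Ty → Set} (f : ∀ {A} → Ξ ∋ A → F A) (g : ∀ {A} → Γ ∋ A → F A)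
              {A} (z : Ξ ∋ A) → copair Ξ {F = F} f g (injˡ z) ≡ f z
copair-injˡ (B ∷ Ξ) f g here      = refl
copair-injˡ (B ∷ Ξ) f g (there z) = copair-injˡ Ξ (λ y → f (there y)) g z

copair-injʳ : ∀ Ξ {Γ} {F : Ty → Set} (f : ∀ {A} → Ξ ∋ A → F A) (g : ∀ {A} → Γ ∋ A → F A)
              {A} (w : Γ ∋ A) → copair Ξ {F = F} f g (injʳ Ξ w) ≡ g w
copair-injʳ []      f g w = refl
copair-injʳ (B ∷ Ξ) f g w = copair-injʳ Ξ (λ y → f (there y)) g w

liftΞ-injˡ : ∀ Ξ {Γ Δ} (σ : Sub Γ Δ) {A} (z : Ξ ∋ A) → liftΞ Ξ σ (injˡ z) ≡ var (injˡ z)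
liftΞ-injˡ (B ∷ Ξ) σ here      = refl
liftΞ-injˡ (B ∷ Ξ) σ (there z) = cong wk (liftΞ-injˡ Ξ σ z)

liftΞ-injʳ : ∀ Ξ {Γ Δ} (σ : Sub Γ Δ) {A} (w : Γ ∋ A) → liftΞ Ξ σ (injʳ Ξ w) ≡ ren (injʳ Ξ) (σ w)
liftΞ-injʳ []      σ w = sym (ren-id (σ w))
liftΞ-injʳ (B ∷ Ξ) σ w = trans (cong wk (liftΞ-injʳ Ξ σ w)) (ren-ren there (injʳ Ξ) (σ w))

infix 4 _≅_

record _≅_ (Γ Δ : Ctx) : Set where
  field
    to      : Ren Γ Δ
    from    : Ren Δ Γ
    from-to : ∀ {A} (x : Γ ∋ A) → from (to x) ≡ x
    to-from : ∀ {A} (y : Δ ∋ A) → to (from y) ≡ y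

open _≅_

≅-refl : ∀ {Γ} → Γ ≅ Γ
≅-refl = record { to = λ x → x ; from = λ x → x ; from-to = λ _ → refl ; to-from = λ _ → refl }

≅-trans : ∀ {Γ Δ Ε} → Γ ≅ Δ → Δ ≅ Ε → Γ ≅ Ε
≅-trans i j = record
  { to      = λ x → to j (to i x)
  ; from    = λ z → from i (from j z)
  ; from-to = λ x → trans (cong (from i) (from-to j (to i x))) (from-to i x)
  ; to-from = λ z → trans (cong (to j) (to-from i (from j z))) (to-from j z)
  }

≅-cons : ∀ {Γ Δ A} → Γ ≅ Δ → (A ∷ Γ) ≅ (A ∷ Δ)
≅-cons i = record
  { to      = liftR (to i)
  ; from    = liftR (from i)
  ; from-to = λ { here → refl ; (there x) → cong there (from-to i x) }
  ; to-from = λ { here → refl ; (there y) → cong there (to-from i y) }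
  }

≅-prefix : ∀ Ξ {Γ Δ} → Γ ≅ Δ → (Ξ ++ Γ) ≅ (Ξ ++ Δ)
≅-prefix []      i = i
≅-prefix (A ∷ Ξ) i = ≅-cons (≅-prefix Ξ i)

++-assoc-≅ : ∀ Ξ {X Γ} → (Ξ ++ (X ++ Γ)) ≅ ((Ξ ++ X) ++ Γ)
++-assoc-≅ []      = ≅-refl
++-assoc-≅ (A ∷ Ξ) = ≅-cons (++-assoc-≅ Ξ)

swap : ∀ Γ Y → Ren (Γ ++ Y) (Y ++ Γ)
swap Γ Y = copair Γ (injʳ Y) injˡ

swap-swap : ∀ Γ Y {A} (x : (Γ ++ Y) ∋ A) → swap Y Γ (swap Γ Y x) ≡ x
swap-swap Γ Y x with split Γ x
... | inˡ c = trans (cong (swap Y Γ) (copair-injˡ Γ (injʳ Y) injˡ c)) (copair-injʳ Y (injʳ Γ) injˡ c)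
... | inʳ y = trans (cong (swap Y Γ) (copair-injʳ Γ (injʳ Y) injˡ y)) (copair-injˡ Y (injʳ Γ) injˡ y)

++-comm-≅ : ∀ Γ Y → (Γ ++ Y) ≅ (Y ++ Γ)
++-comm-≅ Γ Y = record
  { to = swap Γ Y ; from = swap Y Γ ; from-to = swap-swap Γ Y ; to-from = swap-swap Y Γ }

InjectiveSub-∘ˢ : ∀ {Γ Δ Ε} {σ' : Sub Δ Ε} {σ : Sub Γ Δ} →
                  InjectiveSub σ' → InjectiveSub σ → InjectiveSub (σ' ∘ˢ σ)
InjectiveSub-∘ˢ {σ' = σ'} {σ} σ'-inj σ-inj Ξ M N p =
  σ-inj Ξ M N (σ'-inj Ξ _ _ (≈-trans (≡⇒≈ (sym (factor M))) (≈-trans p (≡⇒≈ (factor N)))))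
  where
  factor : ∀ K → sub (liftΞ Ξ (σ' ∘ˢ σ)) K ≡ sub (liftΞ Ξ σ') (sub (liftΞ Ξ σ) K)
  factor K = trans (sub-cong (liftΞ-∘ˢ Ξ σ' σ) K) (sym (sub-sub _ _ K))

-- ϕ is σ lifted past Ξ₀ up to isomorphisms, so ϕ lifted past Ξ is σ lifted past Ξ ++ Ξ₀.
InjectiveSub-conj : ∀ {Γ Δ Γ' Δ'} Ξ₀ (i : Γ ≅ Ξ₀ ++ Γ') (o : Δ ≅ Ξ₀ ++ Δ')
                    {σ : Sub Γ' Δ'} {ϕ : Sub Γ Δ} →
                    (∀ {A} (x : Γ ∋ A) → ϕ x ≡ ren (from o) (liftΞ Ξ₀ σ (to i x))) →
                    InjectiveSub σ → InjectiveSub ϕ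
InjectiveSub-conj {Γ} Ξ₀ i o {σ} {ϕ} ϕ≡ σ-inj Ξ M N p =
  ren-reflects-≈ (to (shift i)) (from (shift i)) (from-to (shift i))
    (σ-inj (Ξ ++ Ξ₀) _ _ (ren-reflects-≈ (from (shift o)) (to (shift o)) (to-from (shift o))
      (≈-trans (≡⇒≈ (sym (image M))) (≈-trans p (≡⇒≈ (image N))))))
  where
  shift : ∀ {Ξ Γ Γ'} → Γ ≅ Ξ₀ ++ Γ' → Ξ ++ Γ ≅ (Ξ ++ Ξ₀) ++ Γ'
  shift {Ξ} j = ≅-trans (≅-prefix Ξ j) (++-assoc-≅ Ξ)
  commute : ∀ Ξ {A} (x : (Ξ ++ Γ) ∋ A) →
            liftΞ Ξ ϕ x ≡ ren (from (shift {Ξ} o)) (liftΞ (Ξ ++ Ξ₀) σ (to (shift {Ξ} i) x))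
  commute []      x         = ϕ≡ x
  commute (B ∷ Ξ) here      = refl
  commute (B ∷ Ξ) (there x) =
    trans (cong wk (commute Ξ x)) (trans (ren-ren there _ _) (sym (ren-ren _ there _)))
  image : ∀ K → sub (liftΞ Ξ ϕ) K ≡ ren (from (shift o)) (sub (liftΞ (Ξ ++ Ξ₀) σ) (ren (to (shift i)) K))
  image K = trans (sub-cong (commute Ξ) K) (trans (sym (sub-ren _ _ K)) (sym (ren-sub _ _ (ren _ K))))

liftΞ-injective : ∀ X {Γ Δ} {σ : Sub Γ Δ} → InjectiveSub σ → InjectiveSub (liftΞ X σ)
liftΞ-injective X = InjectiveSub-conj X ≅-refl ≅-refl (λ x → sym (ren-id _))

liftʳ : ∀ {Γ Θ} Y → Sub Γ Θ → Sub (Γ ++ Y) (Θ ++ Y)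
liftʳ {Γ} {Θ} Y σ = copair Γ (λ c → ren injˡ (σ c)) (λ y → var (injʳ Θ y))

liftʳ-as-conj : ∀ {Γ Θ} Y (σ : Sub Γ Θ) {A} (x : (Γ ++ Y) ∋ A) →
                liftʳ Y σ x ≡ ren (swap Y Θ) (liftΞ Y σ (swap Γ Y x))
liftʳ-as-conj {Γ} {Θ} Y σ x with split Γ x
... | inˡ c = begin
  liftʳ Y σ (injˡ c)
    ≡⟨ copair-injˡ Γ _ _ c ⟩
  ren injˡ (σ c)
    ≡⟨ ren-cong (copair-injʳ Y (injʳ Θ) injˡ) (σ c) ⟨
  ren (λ θ → swap Y Θ (injʳ Y θ)) (σ c)
    ≡⟨ ren-ren (swap Y Θ) (injʳ Y) (σ c) ⟨
  ren (swap Y Θ) (ren (injʳ Y) (σ c))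
    ≡⟨ cong (ren (swap Y Θ)) (liftΞ-injʳ Y σ c) ⟨
  ren (swap Y Θ) (liftΞ Y σ (injʳ Y c))
    ≡⟨ cong (λ v → ren (swap Y Θ) (liftΞ Y σ v)) (copair-injˡ Γ (injʳ Y) injˡ c) ⟨
  ren (swap Y Θ) (liftΞ Y σ (swap Γ Y (injˡ c)))
    ∎
  where open ≡-Reasoning
... | inʳ y = begin
  liftʳ Y σ (injʳ Γ y)
    ≡⟨ copair-injʳ Γ _ _ y ⟩
  var (injʳ Θ y)
    ≡⟨ cong var (copair-injˡ Y (injʳ Θ) injˡ y) ⟨
  ren (swap Y Θ) (var (injˡ y))
    ≡⟨ cong (ren (swap Y Θ)) (liftΞ-injˡ Y σ y) ⟨
  ren (swap Y Θ) (liftΞ Y σ (injˡ y))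
    ≡⟨ cong (λ v → ren (swap Y Θ) (liftΞ Y σ v)) (copair-injʳ Γ (injʳ Y) injˡ y) ⟨
  ren (swap Y Θ) (liftΞ Y σ (swap Γ Y (injʳ Γ y)))
    ∎
  where open ≡-Reasoning

liftʳ-injective : ∀ {Γ Θ} Y {σ : Sub Γ Θ} → InjectiveSub σ → InjectiveSub (liftʳ Y σ)
liftʳ-injective {Γ} {Θ} Y {σ} = InjectiveSub-conj Y (++-comm-≅ Γ Y) (++-comm-≅ Θ Y) (liftʳ-as-conj Y σ)

renSpine : ∀ {Γ Δ C} → Ren Γ Δ → Spine Γ C → Spine Δ C
renSpine ρ []ₛ      = []ₛ
renSpine ρ (u ∷ₛ S) = ren ρ u ∷ₛ renSpine ρ S

ren-apply : ∀ {Γ Δ C} (ρ : Ren Γ Δ) (t : Tm Γ C) (S : Spine Γ C) →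
            ren ρ (apply t S) ≡ apply (ren ρ t) (renSpine ρ S)
ren-apply ρ t []ₛ      = refl
ren-apply ρ t (u ∷ₛ S) = ren-apply ρ (app t u) S

renSpine-reflects : ∀ {Γ Δ C} (ρ : Ren Γ Δ) (ρ⁻¹ : Ren Δ Γ) → (∀ {B} (x : Γ ∋ B) → ρ⁻¹ (ρ x) ≡ x) →
                    (Ms Ns : Spine Γ C) → SpineEq (renSpine ρ Ms) (renSpine ρ Ns) → SpineEq Ms Ns
renSpine-reflects ρ ρ⁻¹ inv []ₛ       []ₛ       []ₑ       = []ₑ
renSpine-reflects ρ ρ⁻¹ inv (M ∷ₛ Ms) (N ∷ₛ Ns) (p ∷ₑ e) =
  ren-reflects-≈ ρ ρ⁻¹ inv p ∷ₑ renSpine-reflects ρ ρ⁻¹ inv Ms Ns e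

HeadEq-map : ∀ {Γ Γ' Δ A B} (f : ∀ {C} → Γ ∋ C → Γ' ∋ C) {a : Γ ∋ A} {b : Γ ∋ B}
             {Ms : Spine Δ A} {Ns : Spine Δ B} → HeadEq a b Ms Ns → HeadEq (f a) (f b) Ms Ns
HeadEq-map f (same e) = same e

HeadEq-there : ∀ {Γ Δ A B C} {a : Γ ∋ A} {b : Γ ∋ B} {Ms : Spine Δ A} {Ns : Spine Δ B} →
               HeadEq {C ∷ Γ} (there a) (there b) Ms Ns → HeadEq a b Ms Ns
HeadEq-there (same e) = same e

HeadEq-injˡ : ∀ {Ξ Γ Δ A B} {a : Ξ ∋ A} {b : Ξ ∋ B} {Ms : Spine Δ A} {Ns : Spine Δ B} →
              HeadEq (injˡ {Γ = Γ} a) (injˡ b) Ms Ns → HeadEq a b Ms Ns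
HeadEq-injˡ {a = here}    {here}    (same e) = same e
HeadEq-injˡ {a = here}    {there b} ()
HeadEq-injˡ {a = there a} {here}    ()
HeadEq-injˡ {a = there a} {there b} h        = HeadEq-map there (HeadEq-injˡ (HeadEq-there h))

HeadEq-injʳ : ∀ Ξ {Γ Δ A B} {a : Γ ∋ A} {b : Γ ∋ B} {Ms : Spine Δ A} {Ns : Spine Δ B} →
              HeadEq (injʳ Ξ a) (injʳ Ξ b) Ms Ns → HeadEq a b Ms Ns
HeadEq-injʳ []      h = h
HeadEq-injʳ (C ∷ Ξ) h = HeadEq-injʳ Ξ (HeadEq-there h)

HeadEq-injˡ-injʳ : ∀ {Ξ Γ Δ A B} {a : Ξ ∋ A} {b : Γ ∋ B} {Ms : Spine Δ A} {Ns : Spine Δ B} →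
                   HeadEq (injˡ a) (injʳ Ξ b) Ms Ns → ⊥
HeadEq-injˡ-injʳ {a = here}    ()
HeadEq-injˡ-injʳ {a = there a} h = HeadEq-injˡ-injʳ {a = a} (HeadEq-there h)

HeadEq-injʳ-injˡ : ∀ {Ξ Γ Δ A B} {a : Γ ∋ A} {b : Ξ ∋ B} {Ms : Spine Δ A} {Ns : Spine Δ B} →
                   HeadEq (injʳ Ξ a) (injˡ b) Ms Ns → ⊥
HeadEq-injʳ-injˡ {b = here}    ()
HeadEq-injʳ-injˡ {b = there b} h = HeadEq-injʳ-injˡ {b = b} (HeadEq-there h)

HeadEq-arg : ∀ {Γ Δ A} {a b : Γ ∋ (A ⇒ ι)} {P Q : Tm Δ A} → HeadEq a b (P ∷ₛ []ₛ) (Q ∷ₛ []ₛ) → P ≈ Q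
HeadEq-arg (same (p ∷ₑ []ₑ)) = p

-- On the fresh context Ξ ++ Δ₀ the reduction acts as the identity, so its atomicity
-- there says that heads are unique; this replaces an appeal to Church–Rosser.
heads-unique : ∀ {Γ₀ Δ₀} {α : Sub Γ₀ Δ₀} → IsAtomicReduction α →
               ∀ Ξ {A B} (x : (Ξ ++ Δ₀) ∋ A) (y : (Ξ ++ Δ₀) ∋ B) (Ms : Spine _ A) (Ns : Spine _ B) →
               apply (var x) Ms ≈ apply (var y) Ns → HeadEq x y Ms Ns
heads-unique {Δ₀ = Δ₀} {α} α-atomic Ξ x y Ms Ns p =
  unrename (HeadEq-injˡ (α-atomic K (injˡ x) (injˡ y) (renSpine injˡ Ms) (renSpine injˡ Ns) p′))
  where
  K = Ξ ++ Δ₀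
  retract : Ren (K ++ Δ₀) K
  retract = copair K (λ v → v) (injʳ Ξ)
  rename : ∀ {C} (v : K ∋ C) (S : Spine K C) →
           ren injˡ (apply (var v) S) ≡ apply (liftΞ K α (injˡ v)) (renSpine injˡ S)
  rename v S = trans (ren-apply injˡ (var v) S)
                     (cong (λ h → apply h (renSpine injˡ S)) (sym (liftΞ-injˡ K α v)))
  p′ : apply (liftΞ K α (injˡ x)) (renSpine injˡ Ms) ≈ apply (liftΞ K α (injˡ y)) (renSpine injˡ Ns)
  p′ = ≈-trans (≡⇒≈ (sym (rename x Ms))) (≈-trans (ren-resp-≈ injˡ p) (≡⇒≈ (rename y Ns)))
  unrename : HeadEq x y (renSpine injˡ Ms) (renSpine injˡ Ns) → HeadEq x y Ms Ns
  unrename (same e) = same (renSpine-reflects injˡ retract (copair-injˡ K (λ v → v) (injʳ Ξ)) Ms Ns e)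

-- Merging two copies of an atomic context

wrap : ∀ {Γ C} → Tm Γ 𝟙 → Tm Γ C → Tm Γ C
wrap {C = ι}     F t = app F t
wrap {C = A ⇒ B} F t = lam (wrap (wk F) (app (wk t) (var here)))

sub-wrap : ∀ {Γ Δ C} (σ : Sub Γ Δ) (F : Tm Γ 𝟙) (t : Tm Γ C) →
           sub σ (wrap F t) ≡ wrap (sub σ F) (sub σ t)
sub-wrap {C = ι}     σ F t = refl
sub-wrap {C = A ⇒ B} σ F t =
  cong lam (trans (sub-wrap (lift σ) (wk F) (app (wk t) (var here)))
                  (cong₂ (λ G s → wrap G (app s (var here))) (lift-wk σ F) (lift-wk σ t)))

ren-wrap : ∀ {Γ Δ C} (ρ : Ren Γ Δ) (F : Tm Γ 𝟙) (t : Tm Γ C) →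
           ren ρ (wrap F t) ≡ wrap (ren ρ F) (ren ρ t)
ren-wrap ρ F t = trans (ren-as-sub ρ (wrap F t))
                       (trans (sub-wrap _ F t) (sym (cong₂ wrap (ren-as-sub ρ F) (ren-as-sub ρ t))))

apps-wrap : ∀ {Γ C} (F : Tm Γ 𝟙) (t : Tm Γ C) (S : Args Γ C ι) → apps (wrap F t) S ≈ app F (apps t S)
apps-wrap F t []ᵃ      = ≈-refl
apps-wrap F t (u ∷ᵃ S) = ≈-trans (apps-resp-≈ S (≈-trans (β _ _) (≡⇒≈ unwrap))) (apps-wrap F (app t u) S)
  where
  unwrap : wrap (wk F) (app (wk t) (var here)) [ u ] ≡ wrap F (app t u)
  unwrap = trans (sub-wrap _ (wk F) (app (wk t) (var here)))
                 (cong₂ (λ G s → wrap G (app s u)) (wk-[] F u) (wk-[] t u))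

-- The left copy of Θ is sent through α f₁, the right copy through α f₂; atomicity of α
-- lets one read off from an image which copy, which variable and which arguments it came from.
module Merge {Θ : Ctx} (α : Sub (𝟙 ∷ 𝟙 ∷ []) Θ) (α-atomic : IsAtomicReduction α) where

  merge : Sub (Θ ++ Θ) Θ
  merge = copair Θ (λ θ → wrap (α here) (var θ)) (λ θ → wrap (α (there here)) (var θ))

  merge↑ : ∀ Ξ → Sub (Ξ ++ (Θ ++ Θ)) (Ξ ++ Θ)
  merge↑ Ξ = liftΞ Ξ merge

  mergeArgs : ∀ Ξ {C T} → NfArgs (Ξ ++ (Θ ++ Θ)) C T → Args (Ξ ++ Θ) C T
  mergeArgs Ξ S = subArgs (merge↑ Ξ) ⌜ S ⌝ᵃ

  data Origin (Ξ : Ctx) {C : Ty} : (Ξ ++ (Θ ++ Θ)) ∋ C → Set where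
    fresh : (z : Ξ ∋ C) → Origin Ξ (injˡ z)
    left  : (θ : Θ ∋ C) → Origin Ξ (injʳ Ξ (injˡ θ))
    right : (θ : Θ ∋ C) → Origin Ξ (injʳ Ξ (injʳ Θ θ))

  origin : ∀ Ξ {C} (x : (Ξ ++ (Θ ++ Θ)) ∋ C) → Origin Ξ x
  origin Ξ x with split Ξ x
  ... | inˡ z = fresh z
  ... | inʳ w with split Θ w
  ...   | inˡ θ = left θ
  ...   | inʳ θ = right θ

  headTy : ∀ {Ξ C} {x : (Ξ ++ (Θ ++ Θ)) ∋ C} → Origin Ξ x → Ty
  headTy {C = C} (fresh z) = C
  headTy         (left θ)  = 𝟙
  headTy         (right θ) = 𝟙

  head : ∀ {Ξ C} {x : (Ξ ++ (Θ ++ Θ)) ∋ C} (o : Origin Ξ x) → (Ξ ++ 𝟙 ∷ 𝟙 ∷ []) ∋ headTy o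
  head     (fresh z) = injˡ z
  head {Ξ} (left θ)  = injʳ Ξ here
  head {Ξ} (right θ) = injʳ Ξ (there here)

  headArgs : ∀ {Ξ C} {x : (Ξ ++ (Θ ++ Θ)) ∋ C} (o : Origin Ξ x) →
             Args (Ξ ++ Θ) C ι → Spine (Ξ ++ Θ) (headTy o)
  headArgs     (fresh z) E = toSpine E
  headArgs {Ξ} (left θ)  E = apps (var (injʳ Ξ θ)) E ∷ₛ []ₛ
  headArgs {Ξ} (right θ) E = apps (var (injʳ Ξ θ)) E ∷ₛ []ₛ

  image-wrapped : ∀ Ξ {C} (w : (Θ ++ Θ) ∋ C) (θ : Θ ∋ C) (f : (𝟙 ∷ 𝟙 ∷ []) ∋ 𝟙) →
                  merge w ≡ wrap (α f) (var θ) → (E : Args (Ξ ++ Θ) C ι) →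
                  apps (merge↑ Ξ (injʳ Ξ w)) E ≈ app (liftΞ Ξ α (injʳ Ξ f)) (apps (var (injʳ Ξ θ)) E)
  image-wrapped Ξ w θ f w↦ E = ≈-trans (≡⇒≈ (cong (λ h → apps h E) merged)) (apps-wrap _ _ E)
    where
    merged : merge↑ Ξ (injʳ Ξ w) ≡ wrap (liftΞ Ξ α (injʳ Ξ f)) (var (injʳ Ξ θ))
    merged = begin
      merge↑ Ξ (injʳ Ξ w)                            ≡⟨ liftΞ-injʳ Ξ merge w ⟩
      ren (injʳ Ξ) (merge w)                         ≡⟨ cong (ren (injʳ Ξ)) w↦ ⟩
      ren (injʳ Ξ) (wrap (α f) (var θ))              ≡⟨ ren-wrap (injʳ Ξ) (α f) (var θ) ⟩
      wrap (ren (injʳ Ξ) (α f)) (var (injʳ Ξ θ))     ≡⟨ cong (λ G → wrap G _) (liftΞ-injʳ Ξ α f) ⟨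
      wrap (liftΞ Ξ α (injʳ Ξ f)) (var (injʳ Ξ θ))   ∎
      where open ≡-Reasoning

  image : ∀ {Ξ C} {x : (Ξ ++ (Θ ++ Θ)) ∋ C} (o : Origin Ξ x) (E : Args _ C ι) →
          sub (merge↑ Ξ) (apps (var x) E) ≈ apply (liftΞ Ξ α (head o)) (headArgs o (subArgs (merge↑ Ξ) E))
  image {Ξ} {x = x} o E = ≈-trans (≡⇒≈ (sub-apps (merge↑ Ξ) (var x) E)) (image-var o _)
    where
    image-var : ∀ {C} {x : (Ξ ++ (Θ ++ Θ)) ∋ C} (o : Origin Ξ x) (E : Args _ C ι) →
                apps (merge↑ Ξ x) E ≈ apply (liftΞ Ξ α (head o)) (headArgs o E)
    image-var (fresh z) E =
      ≡⇒≈ (trans (cong (λ h → apps h E) (trans (liftΞ-injˡ Ξ merge z) (sym (liftΞ-injˡ Ξ α z))))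
                 (apps≡apply _ E))
    image-var (left θ)  E = image-wrapped Ξ (injˡ θ) θ here (copair-injˡ Θ _ _ θ) E
    image-var (right θ) E = image-wrapped Ξ (injʳ Θ θ) θ (there here) (copair-injʳ Θ _ _ θ) E

  mutual
    merge-reflects : ∀ Ξ {A} (m n : Nf (Ξ ++ (Θ ++ Θ)) A) →
                     sub (merge↑ Ξ) ⌜ m ⌝ ≈ sub (merge↑ Ξ) ⌜ n ⌝ → ⌜ m ⌝ ≈ ⌜ n ⌝
    merge-reflects Ξ (lamⁿ m)   (lamⁿ n)    p = cong-lam (merge-reflects (_ ∷ Ξ) m n (lam-injective p))
    merge-reflects Ξ (neuⁿ x S) (neuⁿ y S') p =
      merge-reflects-neu o o' S S' (α-atomic Ξ (head o) (head o') _ _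
        (≈-trans (≈-sym (image o ⌜ S ⌝ᵃ)) (≈-trans p (image o' ⌜ S' ⌝ᵃ))))
      where
      o  = origin Ξ x
      o' = origin Ξ y

    merge-reflects-neu :
      ∀ {Ξ C C'} {x : (Ξ ++ (Θ ++ Θ)) ∋ C} {y : (Ξ ++ (Θ ++ Θ)) ∋ C'} (o : Origin Ξ x) (o' : Origin Ξ y)
      (S : NfArgs _ C ι) (S' : NfArgs _ C' ι) →
      HeadEq (head o) (head o') (headArgs o (mergeArgs Ξ S)) (headArgs o' (mergeArgs Ξ S')) →
      apps (var x) ⌜ S ⌝ᵃ ≈ apps (var y) ⌜ S' ⌝ᵃ
    merge-reflects-neu (fresh z) (fresh z') S S' h with HeadEq-injˡ h
    ... | same e = merge-reflects-args S S' e (var (injˡ z))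
    merge-reflects-neu (fresh z) (left θ')  S S' h = ⊥-elim (HeadEq-injˡ-injʳ h)
    merge-reflects-neu (fresh z) (right θ') S S' h = ⊥-elim (HeadEq-injˡ-injʳ h)
    merge-reflects-neu (left θ)  (fresh z') S S' h = ⊥-elim (HeadEq-injʳ-injˡ h)
    merge-reflects-neu (right θ) (fresh z') S S' h = ⊥-elim (HeadEq-injʳ-injˡ h)
    merge-reflects-neu {Ξ} (left θ)  (right θ') S S' h with HeadEq-injʳ Ξ h
    ... | ()
    merge-reflects-neu {Ξ} (right θ) (left θ')  S S' h with HeadEq-injʳ Ξ h
    ... | ()
    merge-reflects-neu (left θ)  (left θ')  S S' h = merge-reflects-copy injˡ θ θ' S S' (HeadEq-arg h)
    merge-reflects-neu (right θ) (right θ') S S' h = merge-reflects-copy (injʳ Θ) θ θ' S S' (HeadEq-arg h)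

    merge-reflects-copy :
      ∀ {Ξ C C'} (copy : ∀ {A} → Θ ∋ A → (Θ ++ Θ) ∋ A) (θ : Θ ∋ C) (θ' : Θ ∋ C')
      (S : NfArgs (Ξ ++ (Θ ++ Θ)) C ι) (S' : NfArgs _ C' ι) →
      apps (var (injʳ Ξ θ)) (mergeArgs Ξ S) ≈ apps (var (injʳ Ξ θ')) (mergeArgs Ξ S') →
      apps (var (injʳ Ξ (copy θ))) ⌜ S ⌝ᵃ ≈ apps (var (injʳ Ξ (copy θ'))) ⌜ S' ⌝ᵃ
    merge-reflects-copy {Ξ} copy θ θ' S S' q
      with HeadEq-injʳ Ξ (heads-unique α-atomic Ξ (injʳ Ξ θ) (injʳ Ξ θ')
                                       (toSpine (mergeArgs Ξ S)) (toSpine (mergeArgs Ξ S')) q′)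
      where
      q′ : apply (var (injʳ Ξ θ)) (toSpine (mergeArgs Ξ S)) ≈ apply (var (injʳ Ξ θ')) (toSpine (mergeArgs Ξ S'))
      q′ = ≈-trans (≡⇒≈ (sym (apps≡apply (var (injʳ Ξ θ)) (mergeArgs Ξ S))))
                   (≈-trans q (≡⇒≈ (apps≡apply (var (injʳ Ξ θ')) (mergeArgs Ξ S'))))
    ... | same e = merge-reflects-args S S' e (var (injʳ Ξ (copy θ)))

    merge-reflects-args : ∀ {Ξ C} (S S' : NfArgs (Ξ ++ (Θ ++ Θ)) C ι) →
      SpineEq (toSpine (mergeArgs Ξ S)) (toSpine (mergeArgs Ξ S')) →
      (t : Tm _ C) → apps t ⌜ S ⌝ᵃ ≈ apps t ⌜ S' ⌝ᵃ
    merge-reflects-args []ⁿ      []ⁿ        []ₑ      t = ≈-refl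
    merge-reflects-args (m ∷ⁿ S) (n ∷ⁿ S') (p ∷ₑ e) t =
      ≈-trans (apps-resp-≈ ⌜ S ⌝ᵃ (cong-app ≈-refl (merge-reflects _ m n p)))
              (merge-reflects-args S S' e (app t ⌜ n ⌝))

  merge-injective : InjectiveSub merge
  merge-injective Ξ M N p with normalise M | normalise N
  ... | m , M≈m | n , N≈n = ≈-trans M≈m (≈-trans (merge-reflects Ξ m n images≈) (≈-sym N≈n))
    where
    images≈ : sub (merge↑ Ξ) ⌜ m ⌝ ≈ sub (merge↑ Ξ) ⌜ n ⌝
    images≈ = ≈-trans (sub-resp-≈ (merge↑ Ξ) (≈-sym M≈m)) (≈-trans p (sub-resp-≈ (merge↑ Ξ) N≈n))

mainTheorem3 : (Γ Δ Θ : Ctx) → AtomicCtx Θ → Γ ≤ˢ Θ → Δ ≤ˢ Θ → (Γ ++ Δ) ≤ˢ Θ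
mainTheorem3 Γ Δ Θ (α , α-atomic) (σ , σ-inj) (τ , τ-inj) =
  merge ∘ˢ liftʳ Θ σ ∘ˢ liftΞ Γ τ ,
  InjectiveSub-∘ˢ merge-injective (InjectiveSub-∘ˢ (liftʳ-injective Θ σ-inj) (liftΞ-injective Γ τ-inj))
  where open Merge α α-atomic
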